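{- Let $\varphi$ be a conjunctive quantifier-free formula over fixed-size arrays of finite-domain variables and finite-domain constraints over indexes and elements, as described in the context, and consider the procedure FDCC applied to $\varphi$. Assume that the filtering performed by the finite-domain solver FD is strongly correct. Then: (i) FDCC-propagation terminates; (ii) FDCC-propagation is correct, i.e. it never removes a value of a variable that occurs in some solution of $\varphi$, and every equality or disequality it deduces holds in every solution of $\varphi$; (iii) FDCC is correct and complete as a decision procedure: on every input $\varphi$ it terminates, and when it answers "unsat" the formula $\varphi$ has no solution, while when it answers "sat" the full instantiation it returns is a solution of $\varphi$.
   Context: Formulas. $\varphi$ is a finite conjunction of atoms built from: finite-domain variables (each variable $x$ has a finite set $D(x)$ of integer values), arrays of known fixed size whose cells are finite-domain variables, terms $select(A,i)$ (value of array $A$ at index $i$) and $store(A,i,e)$ (array equal to $A$ except that index $i$ holds $e$), equalities and disequalities between terms, and arbitrary finite-domain constraints (e.g. linear or non-linear arithmetic) over indexes and elements. The semantics of $select/store$ is given by the array axioms: $i=j \Rightarrow select(A,i)=select(A,j)$; $i=j \Rightarrow select(store(A,i,e),j)=e$; $i\neq j \Rightarrow select(store(A,i,e),j)=select(A,j)$. A solution of $\varphi$ is an assignment of values from the domains to all variables satisfying all atoms. Procedure FDCC. It combines two solvers. (1) CC: a congruence-closure procedure over the terms of $\varphi$ maintaining equivalence classes of terms and a set of disequalities between classes, closed under the rules FC-1: $i=j \to select(A,i)=select(A,j)$; FC-2: $select(A,i)\neq select(A,j)\to i\neq j$; RoW-1-1: $i=j\to select(store(A,i,e),j)=e$; RoW-1-2: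 $select(store(A,i,e),j)\neq e\to i\neq j$; RoW-2-1: $i\neq j\to select(store(A,i,e),j)=select(A,j)$; RoW-2-2 (only when $select(A,j)$ occurs in $\varphi$): $select(store(A,i,e),j)\neq select(A,j)\to i=j$. CC reports unsatisfiability when two terms of the same class are required to be different. (2) FD: a finite-domain constraint solver with propagators (domain-filtering algorithms) for all atomic constraints, including propagators for $select$ and $store$ over fixed-size arrays and for AllDifferent. A propagator is correct if every value it removes from a domain belongs to no solution; it is strongly correct if it is correct and, on fully instantiated inputs, it accepts exactly the solutions. FDCC-propagation: CC sends to FD every equality and disequality it deduces, and an AllDifferent constraint for each detected 3-clique of pairwise disequal terms; a supervisor queries FD on the current critical pairs (for each term $t=select(store(A,i,e),j)$: the pairs $(i,j)$, $(t,e)$, and $(t,select(A,j))$ when $select(A,j)$ occurs), and FD answers with the equalities/disequalities it can establish from domain information (e.g. disjoint domains give a disequality), which are sent to CC; this exchange is repeated until no new information is produced or a contradiction is found. FDCC then performs labelling with backtracking: it picks a variable $x$ and value $k$ and branches on $x=k$ or $x\neq k$ in FD, applying FDCC-propagation in each branch; it answers "unsat" if all branches fail and "sat", returning the instantiation, when a full instantiation of the variables is accepted by FD. -}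

module Defs where

open import Data.Nat using (ℕ; _<_)
open import Data.Integer using (ℤ; +_)
import Data.Integer as ℤ
open import Data.Bool using (Bool; T; if_then_else_)
open import Data.Fin using (Fin; fromℕ<)
import Data.Fin as Fin
open import Data.List using (List; []; _∷_; _++_; filter)
open import Data.List.Membership.Propositional using (_∈_; _∉_)
open import Data.List.Relation.Unary.All using (All)
open import Data.Product using (Σ; ∃; ∃₂; _×_; _,_)
open import Data.Sum using (_⊎_)
open import Data.Empty using (⊥)
open import Data.Unit using (⊤)
open import Relation.Nullary using (¬_; ¬?; does)
open import Relation.Binary.PropositionalEquality using (_≡_; _≢_)
open import Relation.Binary.Construct.Closure.ReflexiveTransitive using (Star)

-- Flat atoms of a conjunctive formula.
--   n : number of finite-domain (integer) variables
--   m : number of array variables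
-- Array terms select/store are given in flat form:
--   sel v a i      means   v = select(a , i)
--   sto b a i e    means   b = store(a , i , e)
-- 'user f' is an arbitrary finite-domain constraint over the variables.

data Atom (n m : ℕ) : Set where
  eqS neqS : Fin n → Fin n → Atom n m
  eqA neqA : Fin m → Fin m → Atom n m
  sel      : (v : Fin n) (a : Fin m) (i : Fin n) → Atom n m
  sto      : (b a : Fin m) (i e : Fin n) → Atom n m
  alldiff  : Fin n → Fin n → Fin n → Atom n m
  user     : ((Fin n → ℤ) → Bool) → Atom n m

record Formula : Set where
  field
    n    : ℕ
    m    : ℕ
    sz   : Fin m → ℕ
    cell : (a : Fin m) → Fin (sz a) → Fin n
    D    : Fin n → List ℤ
    φ    : List (Atom n m)

module Semantics (F : Formula) where
  open Formula F

  Assignment : Set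
  Assignment = Fin n → ℤ

  Store : Set
  Store = Fin n → List ℤ

  val : Assignment → (a : Fin m) → (k : ℕ) → k < sz a → ℤ
  val ρ a k p = ρ (cell a (fromℕ< p))

  ArrEq : Assignment → Fin m → Fin m → Set
  ArrEq ρ a b = (sz a ≡ sz b) × (∀ k (p : k < sz a) (q : k < sz b) → val ρ a k p ≡ val ρ b k q)

  ⟦_⟧ : Atom n m → Assignment → Set
  ⟦ eqS x y ⟧ ρ = ρ x ≡ ρ y
  ⟦ neqS x y ⟧ ρ = ρ x ≢ ρ y
  ⟦ eqA a b ⟧ ρ = ArrEq ρ a b
  ⟦ neqA a b ⟧ ρ = ¬ ArrEq ρ a b
  ⟦ sel v a i ⟧ ρ = Σ ℕ λ k → (ρ i ≡ + k) × Σ (k < sz a) λ p → ρ v ≡ val ρ a k p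
  ⟦ sto b a i e ⟧ ρ = (sz b ≡ sz a) × Σ ℕ λ k → (ρ i ≡ + k) × (k < sz a) ×
      (∀ l (p : l < sz a) (q : l < sz b) →
         (l ≡ k → val ρ b l q ≡ ρ e) × (l ≢ k → val ρ b l q ≡ val ρ a l p))
  ⟦ alldiff x y z ⟧ ρ = (ρ x ≢ ρ y) × (ρ y ≢ ρ z) × (ρ x ≢ ρ z)
  ⟦ user f ⟧ ρ = T (f ρ)

  Solution : Assignment → Set
  Solution ρ = (∀ x → ρ x ∈ D x) × All (λ c → ⟦ c ⟧ ρ) φ

  InStore : Assignment → Store → Set
  InStore ρ S = ∀ x → ρ x ∈ S x

  Instantiated : Store → Assignment → Set
  Instantiated S ρ = ∀ x → (ρ x ∈ S x) × (∀ v → v ∈ S x → v ≡ ρ x)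

  NonFailed : Store → Set
  NonFailed S = ∀ x → ∃ λ v → v ∈ S x

  Propagators : Set
  Propagators = Atom n m → Store → Store

  record StronglyCorrect (prop : Propagators) : Set where
    field
      filtering : ∀ c S x v → v ∈ prop c S x → v ∈ S x
      correct   : ∀ c S ρ → InStore ρ S → ⟦ c ⟧ ρ → InStore ρ (prop c S)
      accepts   : ∀ c S ρ → Instantiated S ρ → NonFailed (prop c S) → ⟦ c ⟧ ρ
      accepts′  : ∀ c S ρ → Instantiated S ρ → ⟦ c ⟧ ρ → NonFailed (prop c S)

  data _⊢_≈S_ (L : List (Atom n m)) : Fin n → Fin n → Set where
    base  : ∀ {x y} → eqS x y ∈ L → L ⊢ x ≈S y
    refl  : ∀ {x} → L ⊢ x ≈S x
    sym   : ∀ {x y} → L ⊢ x ≈S y → L ⊢ y ≈S x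
    trans : ∀ {x y z} → L ⊢ x ≈S y → L ⊢ y ≈S z → L ⊢ x ≈S z

  data _⊢_≈A_ (L : List (Atom n m)) : Fin m → Fin m → Set where
    base  : ∀ {x y} → eqA x y ∈ L → L ⊢ x ≈A y
    refl  : ∀ {x} → L ⊢ x ≈A x
    sym   : ∀ {x y} → L ⊢ x ≈A y → L ⊢ y ≈A x
    trans : ∀ {x y z} → L ⊢ x ≈A y → L ⊢ y ≈A z → L ⊢ x ≈A z

  _⊢_≉S_ : List (Atom n m) → Fin n → Fin n → Set
  L ⊢ x ≉S y = ∃₂ λ x′ y′ → (L ⊢ x ≈S x′) × (L ⊢ y ≈S y′) × (neqS x′ y′ ∈ L ⊎ neqS y′ x′ ∈ L)

  _⊢_≉A_ : List (Atom n m) → Fin m → Fin m → Set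
  L ⊢ x ≉A y = ∃₂ λ x′ y′ → (L ⊢ x ≈A x′) × (L ⊢ y ≈A y′) × (neqA x′ y′ ∈ L ⊎ neqA y′ x′ ∈ L)

  Conflict : List (Atom n m) → Set
  Conflict L = (∃₂ λ x y → (L ⊢ x ≈S y) × (L ⊢ x ≉S y))
             ⊎ (∃₂ λ a b → (L ⊢ a ≈A b) × (L ⊢ a ≉A b))

  data Deduce (L : List (Atom n m)) : Atom n m → Set where
    fc-1    : ∀ {v w a a′ i j} → sel v a i ∈ L → sel w a′ j ∈ L →
              L ⊢ a ≈A a′ → L ⊢ i ≈S j → Deduce L (eqS v w)
    fc-2    : ∀ {v w a a′ i j} → sel v a i ∈ L → sel w a′ j ∈ L →
              L ⊢ a ≈A a′ → L ⊢ v ≉S w → Deduce L (neqS i j)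
    cong-st : ∀ {b b′ a a′ i i′ e e′} → sto b a i e ∈ L → sto b′ a′ i′ e′ ∈ L →
              L ⊢ a ≈A a′ → L ⊢ i ≈S i′ → L ⊢ e ≈S e′ → Deduce L (eqA b b′)
    row-1-1 : ∀ {b b′ a i e v j} → sto b a i e ∈ L → sel v b′ j ∈ L →
              L ⊢ b ≈A b′ → L ⊢ i ≈S j → Deduce L (eqS v e)
    row-1-2 : ∀ {b b′ a i e v j} → sto b a i e ∈ L → sel v b′ j ∈ L →
              L ⊢ b ≈A b′ → L ⊢ v ≉S e → Deduce L (neqS i j)
    row-2-1 : ∀ {b b′ a i e v j} → sto b a i e ∈ L → sel v b′ j ∈ L →
              L ⊢ b ≈A b′ → L ⊢ i ≉S j → Deduce L (sel v a j)
    row-2-2 : ∀ {b b′ a i e v j w} → sto b a i e ∈ L → sel v b′ j ∈ L →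
              L ⊢ b ≈A b′ → sel w a j ∈ φ → L ⊢ v ≉S w → Deduce L (eqS i j)
    clique  : ∀ {x y z} → L ⊢ x ≉S y → L ⊢ y ≉S z → L ⊢ x ≉S z →
              Deduce L (alldiff x y z)

  Entailed : List (Atom n m) → Atom n m → Set
  Entailed L (eqS x y) = L ⊢ x ≈S y
  Entailed L (neqS x y) = L ⊢ x ≉S y
  Entailed L (eqA a b) = L ⊢ a ≈A b
  Entailed L (neqA a b) = L ⊢ a ≉A b
  Entailed L (sel v a i) = sel v a i ∈ L
  Entailed L (sto b a i e) = sto b a i e ∈ L
  Entailed L (alldiff x y z) = alldiff x y z ∈ L
  Entailed L (user f) = ⊤

  -- critical pairs of φ, for each t = select(store(A,i,e),j)
  data CritPair : Fin n → Fin n → Set where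
    cp-idx : ∀ {b a i e v j} → sto b a i e ∈ φ → sel v b j ∈ φ → CritPair i j
    cp-val : ∀ {b a i e v j} → sto b a i e ∈ φ → sel v b j ∈ φ → CritPair v e
    cp-old : ∀ {b a i e v j w} → sto b a i e ∈ φ → sel v b j ∈ φ →
             sel w a j ∈ φ → CritPair v w

  DomEq : Store → Fin n → Fin n → Set
  DomEq S x y = ∀ u v → u ∈ S x → v ∈ S y → u ≡ v

  DomNeq : Store → Fin n → Fin n → Set
  DomNeq S x y = ∀ u v → u ∈ S x → v ∈ S y → u ≢ v

  record State : Set where
    constructor mkState
    field
      store : Store
      facts : List (Atom n m)
  open State public

  posted : State → List (Atom n m)
  posted s = φ ++ facts s

  Failed : State → Set
  Failed s = (∃ λ x → ∀ v → v ∉ store s x) ⊎ Conflict (posted s)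

  Compatible : Assignment → State → Set
  Compatible ρ s = InStore ρ (store s) × All (λ f → ⟦ f ⟧ ρ) (facts s)

  initial : State
  initial = mkState D []

  setDom : Store → Fin n → List ℤ → Store
  setDom S x l y = if does (y Fin.≟ x) then l else S y

  assign : State → Fin n → ℤ → State
  assign s x k = mkState (setDom (store s) x (k ∷ [])) (facts s)

  exclude : State → Fin n → ℤ → State
  exclude s x k = mkState (setDom (store s) x (filter (λ v → ¬? (v ℤ.≟ k)) (store s x))) (facts s)

  module Procedure (prop : Propagators) where

    data _⟶_ : State → State → Set where
      cc    : ∀ {s f} → ¬ Failed s → Deduce (posted s) f → ¬ Entailed (posted s) f →
              s ⟶ mkState (store s) (f ∷ facts s)
      supEq : ∀ {s x y} → ¬ Failed s → CritPair x y → DomEq (store s) x y →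
              ¬ Entailed (posted s) (eqS x y) →
              s ⟶ mkState (store s) (eqS x y ∷ facts s)
      supNeq : ∀ {s x y} → ¬ Failed s → CritPair x y → DomNeq (store s) x y →
              ¬ Entailed (posted s) (neqS x y) →
              s ⟶ mkState (store s) (neqS x y ∷ facts s)
      fd    : ∀ {s c} → ¬ Failed s → c ∈ posted s →
              (∃₂ λ x v → v ∈ store s x × v ∉ prop c (store s) x) →
              s ⟶ mkState (prop c (store s)) (facts s)

    Stuck : State → Set
    Stuck s = ¬ (∃ λ s′ → s ⟶ s′)

    Accepted : State → Set
    Accepted s = ∀ c → c ∈ posted s → NonFailed (prop c (store s))

    -- FDCC with labelling: configurations hold a stack of pending branches
    data Config : Set where
      search : List State → Config
      sat    : Assignment → Config
      unsat  : Config

    data IsAnswer : Config → Set where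
      isSat   : ∀ ρ → IsAnswer (sat ρ)
      isUnsat : IsAnswer unsat

    data _⇒_ : Config → Config → Set where
      exhausted : search [] ⇒ unsat
      propagate : ∀ {s s′ st} → s ⟶ s′ → search (s ∷ st) ⇒ search (s′ ∷ st)
      backtrack : ∀ {s st} → Stuck s → Failed s → search (s ∷ st) ⇒ search st
      accept    : ∀ {s st ρ} → Stuck s → ¬ Failed s → Instantiated (store s) ρ →
                  Accepted s → search (s ∷ st) ⇒ sat ρ
      reject    : ∀ {s st ρ} → Stuck s → ¬ Failed s → Instantiated (store s) ρ →
                  ¬ Accepted s → search (s ∷ st) ⇒ search st
      label     : ∀ {s st x k v} → Stuck s → ¬ Failed s → k ∈ store s x →
                  v ∈ store s x → v ≢ k →
                  search (s ∷ st) ⇒ search (assign s x k ∷ exclude s x k ∷ st)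

    start : Config
    start = search (initial ∷ [])

-- Every CC rule and every supervisor answer holds in all solutions, and every
-- propagator is correct, so a solution compatible with a state stays compatible
-- along propagation; labelling splits a domain, so some pending state always
-- keeps the solution and "unsat" is never reached from a satisfiable formula.
-- A "sat" answer comes from a fully instantiated state accepted by every
-- propagator, which by strong correctness is a solution.
-- A propagation step either removes one of the finitely many (variable, value)
-- entries of the domains or adds one of the finitely many atoms over the
-- variables that is not yet known, so the number μ of remaining entries and
-- unknown atoms decreases; a search step replaces the top state by at most two
-- states of smaller μ, so the sum of 3^μ over the stack decreases.
module Submission where

open import Defs
open import Data.Product using (_×_; ∃)
open import Function using (flip)
open import Relation.Nullary using (¬_)
open import Induction.WellFounded using (WellFounded)
open import Relation.Binary.Construct.Closure.ReflexiveTransitive using (Star)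

open import Level using (Level)
open import Data.Nat using (ℕ; suc; _+_; _*_; _<_; _≤_; _^_; z≤n; s≤s)
open import Data.Nat.Properties
  using ( ≤∧≢⇒<; +-mono-≤; +-monoˡ-<; +-monoʳ-<; +-assoc; +-identityʳ; *-monoˡ-<
        ; ^-monoʳ-≤; ^-monoʳ-<; m^n>0; m^n≢0; <-irrelevant; module ≤-Reasoning)
open import Data.Nat.Induction using (<-wellFounded)
import Data.Nat as ℕ
open import Data.Integer using (ℤ)
import Data.Integer as ℤ
open import Data.Integer.Properties using (+-injective)
open import Data.Fin using (Fin)
import Data.Fin as Fin
import Data.Fin.Properties as Fin
open import Data.Maybe using (Maybe; just; nothing)
import Data.Maybe.Properties as Maybe
import Data.Sum.Properties as Sum
import Data.Product.Properties as Product
open import Data.List using (List; []; _∷_; _++_; map; filter; length; cartesianProduct; allFin; concatMap)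
open import Data.Nat.ListAction using (sum)
open import Data.List.Membership.Propositional using (_∈_; _∉_; lose; find)
open import Data.List.Membership.Propositional.Properties
  using (∈-++⁺ˡ; ∈-++⁺ʳ; ∈-map⁺; ∈-cartesianProduct⁺; ∈-allFin; ∈-concatMap⁺; ∈-filter⁺; ∈-filter⁻)
import Data.List.Membership.DecPropositional as DecMembership
open import Data.List.Relation.Unary.Any as Any using (Any; here; there; any?)
open import Data.List.Relation.Unary.All as All using (All; []; _∷_)
open import Data.List.Relation.Unary.All.Properties using (++⁺)
import Data.List.Relation.Binary.Sublist.Propositional as Sublist
open import Data.List.Relation.Binary.Sublist.Heterogeneous.Properties using (length-mono-≤; ⊆-filter-Sublist; toPointwise)
open import Data.List.Relation.Binary.Pointwise using (Pointwise-≡⇒≡)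
open import Data.Product using (Σ; ∃₂; _,_; proj₁; proj₂)
open import Data.Sum using (_⊎_; inj₁; inj₂; [_,_]′)
open import Data.Empty using (⊥; ⊥-elim)
open import Data.Unit using (⊤; tt)
open import Function using (_∘_; id)
open import Relation.Nullary using (yes; no; Dec; ¬?)
open import Relation.Nullary.Decidable using (decidable-stable; map′)
open import Relation.Unary using (Pred; Decidable; _⊆_)
open import Relation.Binary using (Rel; DecidableEquality)
open import Relation.Binary.PropositionalEquality
  using (_≡_; _≢_; refl; cong; subst)
import Relation.Binary.PropositionalEquality as ≡
open import Induction.WellFounded using (Acc; acc)
open import Relation.Binary.Construct.Closure.ReflexiveTransitive using (fold)

module _ {a ℓ p : Level} {A : Set a} {_↝_ : Rel A ℓ} where

  Star-preserves : {P : Pred A p} → (∀ {x y} → x ↝ y → P x → P y) →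
                   ∀ {x y} → Star _↝_ x y → P x → P y
  Star-preserves {P} pres = fold (λ x y → P x → P y) (λ step rest → rest ∘ pres step) id

  accessible-by-measure : (Inv : Pred A p) (f : A → ℕ) →
                          (∀ {x y} → x ↝ y → Inv x → Inv y × f y < f x) →
                          ∀ {x} → Inv x → Acc (flip _↝_) x
  accessible-by-measure Inv f decreasing {x} = go (<-wellFounded (f x))
    where
    go : ∀ {x} → Acc _<_ (f x) → Inv x → Acc (flip _↝_) x
    go (acc smaller) inv = acc λ step →
      let (inv′ , lt) = decreasing step inv in go (smaller lt) inv′

module _ {a p q : Level} {A : Set a} {P : Pred A p} {Q : Pred A q}
         (P? : Decidable P) (Q? : Decidable Q) (Q⊆P : Q ⊆ P) where

  filter-sublist : ∀ xs → filter Q? xs Sublist.⊆ filter P? xs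
  filter-sublist xs = ⊆-filter-Sublist Q? P? (λ { refl → Q⊆P }) (Sublist.⊆-refl {x = xs})

  length-filter-mono : ∀ xs → length (filter Q? xs) ≤ length (filter P? xs)
  length-filter-mono xs = length-mono-≤ (filter-sublist xs)

  length-filter-strict : ∀ xs {y} → y ∈ xs → P y → ¬ Q y →
                         length (filter Q? xs) < length (filter P? xs)
  length-filter-strict xs {y} y∈ py ¬qy = ≤∧≢⇒< (length-filter-mono xs) λ same →
    ¬qy (proj₂ (∈-filter⁻ Q? {xs = xs}
      (subst (y ∈_) (≡.sym (Pointwise-≡⇒≡ (toPointwise same (filter-sublist xs)))) (∈-filter⁺ P? y∈ py))))

module _ {a b : Level} {A : Set a} {B : Set b} where

  infixr 5 _⊕_
  _⊕_ : List A → List B → List (A ⊎ B)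
  xs ⊕ ys = map inj₁ xs ++ map inj₂ ys

  ⊕-complete : {xs : List A} {ys : List B} → (∀ x → x ∈ xs) → (∀ y → y ∈ ys) → ∀ z → z ∈ xs ⊕ ys
  ⊕-complete cx cy (inj₁ x) = ∈-++⁺ˡ (∈-map⁺ inj₁ (cx x))
  ⊕-complete {xs} cx cy (inj₂ y) = ∈-++⁺ʳ (map inj₁ xs) (∈-map⁺ inj₂ (cy y))

  ⊗-complete : {xs : List A} {ys : List B} → (∀ x → x ∈ xs) → (∀ y → y ∈ ys) →
               ∀ z → z ∈ cartesianProduct xs ys
  ⊗-complete cx cy (x , y) = ∈-cartesianProduct⁺ (cx x) (cy y)

-- base 3 rather than 2: the two halves of a labelled state must weigh strictly
-- less than the state itself
3^m+3^n<3^o : ∀ {m n o} → m < o → n < o → 3 ^ m + 3 ^ n < 3 ^ o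
3^m+3^n<3^o {m} {n} {suc o} (s≤s m≤o) (s≤s n≤o) = begin-strict
  3 ^ m + 3 ^ n  ≤⟨ +-mono-≤ (^-monoʳ-≤ 3 m≤o) (^-monoʳ-≤ 3 n≤o) ⟩
  3 ^ o + 3 ^ o  ≡⟨ cong (3 ^ o +_) (≡.sym (+-identityʳ (3 ^ o))) ⟩
  2 * 3 ^ o      <⟨ *-monoˡ-< (3 ^ o) {{m^n≢0 3 o}} {2} {3} (s≤s (s≤s (s≤s z≤n))) ⟩
  3 ^ suc o      ∎
  where open ≤-Reasoning

module ArraySemantics (F : Formula) where
  open Formula F
  open Semantics F

  val-irrelevant : ∀ ρ a k (p q : k < sz a) → val ρ a k p ≡ val ρ a k q
  val-irrelevant ρ a k p q = cong (val ρ a k) (<-irrelevant p q)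

  ArrEq-refl : ∀ ρ a → ArrEq ρ a a
  ArrEq-refl ρ a = refl , val-irrelevant ρ a

  ArrEq-sym : ∀ ρ {a b} → ArrEq ρ a b → ArrEq ρ b a
  ArrEq-sym ρ (same-size , same-cells) = ≡.sym same-size , λ k p q → ≡.sym (same-cells k q p)

  ArrEq-trans : ∀ ρ {a b c} → ArrEq ρ a b → ArrEq ρ b c → ArrEq ρ a c
  ArrEq-trans ρ (sz₁ , cells₁) (sz₂ , cells₂) = ≡.trans sz₁ sz₂ , λ k p r →
    let q = subst (k <_) sz₁ p in ≡.trans (cells₁ k p q) (cells₂ k q r)

  select-congruent : ∀ ρ {v w a a′ i j} → ⟦ sel v a i ⟧ ρ → ⟦ sel w a′ j ⟧ ρ →
                     ArrEq ρ a a′ → ρ i ≡ ρ j → ρ v ≡ ρ w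
  select-congruent ρ (k , ρi≡k , p , ρv≡) (k′ , ρj≡k′ , p′ , ρw≡) (_ , same-cells) ρi≡ρj
    with +-injective (≡.trans (≡.sym ρi≡k) (≡.trans ρi≡ρj ρj≡k′))
  ... | refl = ≡.trans ρv≡ (≡.trans (same-cells k p p′) (≡.sym ρw≡))

  read-over-write-hit : ∀ ρ {b b′ a i e v j} → ⟦ sto b a i e ⟧ ρ → ⟦ sel v b′ j ⟧ ρ →
                        ArrEq ρ b b′ → ρ i ≡ ρ j → ρ v ≡ ρ e
  read-over-write-hit ρ (sz-ba , k , ρi≡k , k<sz , cells) (k′ , ρj≡k′ , p′ , ρv≡) (_ , same-cells) ρi≡ρj
    with +-injective (≡.trans (≡.sym ρi≡k) (≡.trans ρi≡ρj ρj≡k′))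
  ... | refl = let q = subst (k <_) (≡.sym sz-ba) k<sz in
    ≡.trans ρv≡ (≡.trans (≡.sym (same-cells k q p′)) (proj₁ (cells k k<sz q) refl))

  read-over-write-miss : ∀ ρ {b b′ a i e v j} → ⟦ sto b a i e ⟧ ρ → ⟦ sel v b′ j ⟧ ρ →
                         ArrEq ρ b b′ → ρ i ≢ ρ j → ⟦ sel v a j ⟧ ρ
  read-over-write-miss ρ (sz-ba , k , ρi≡k , _ , cells) (k′ , ρj≡k′ , p′ , ρv≡) (sz-bb′ , same-cells) ρi≢ρj =
    k′ , ρj≡k′ , p , ≡.trans ρv≡ (≡.trans (≡.sym (same-cells k′ q p′)) (proj₂ (cells k′ p q) k′≢k))
    where
    q = subst (k′ <_) (≡.sym sz-bb′) p′
    p = subst (k′ <_) sz-ba q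
    k′≢k : k′ ≢ k
    k′≢k refl = ρi≢ρj (≡.trans ρi≡k (≡.sym ρj≡k′))

  store-congruent : ∀ ρ {b b′ a a′ i i′ e e′} → ⟦ sto b a i e ⟧ ρ → ⟦ sto b′ a′ i′ e′ ⟧ ρ →
                    ArrEq ρ a a′ → ρ i ≡ ρ i′ → ρ e ≡ ρ e′ → ArrEq ρ b b′
  store-congruent ρ {b} {b′} {a} {a′} (sz-ba , k , ρi≡k , _ , cells) (sz-ba′ , k′ , ρi′≡k′ , _ , cells′)
                  (sz-aa′ , same-cells) ρi≡ρi′ ρe≡ρe′
    with +-injective (≡.trans (≡.sym ρi≡k) (≡.trans ρi≡ρi′ ρi′≡k′))
  ... | refl = ≡.trans sz-ba (≡.trans sz-aa′ (≡.sym sz-ba′)) , same-cell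
    where
    inA : ∀ {l} → l < sz b → l < sz a
    inA = subst (_ <_) sz-ba
    inA′ : ∀ {l} → l < sz b′ → l < sz a′
    inA′ = subst (_ <_) sz-ba′
    same-cell : ∀ l q q′ → val ρ b l q ≡ val ρ b′ l q′
    same-cell l q q′ with l ℕ.≟ k
    ... | yes l≡k = ≡.trans (proj₁ (cells l (inA q) q) l≡k)
                      (≡.trans ρe≡ρe′ (≡.sym (proj₁ (cells′ l (inA′ q′) q′) l≡k)))
    ... | no l≢k = ≡.trans (proj₂ (cells l (inA q) q) l≢k)
                      (≡.trans (same-cells l (inA q) (inA′ q′)) (≡.sym (proj₂ (cells′ l (inA′ q′) q′) l≢k)))

  module _ (ρ : Assignment) {L : List (Atom n m)} (L-holds : All (λ c → ⟦ c ⟧ ρ) L) where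

    ∈-sound : ∀ {c} → c ∈ L → ⟦ c ⟧ ρ
    ∈-sound = All.lookup L-holds

    ≈S-sound : ∀ {x y} → L ⊢ x ≈S y → ρ x ≡ ρ y
    ≈S-sound (base x≈y) = ∈-sound x≈y
    ≈S-sound refl = refl
    ≈S-sound (sym x≈y) = ≡.sym (≈S-sound x≈y)
    ≈S-sound (trans x≈y y≈z) = ≡.trans (≈S-sound x≈y) (≈S-sound y≈z)

    ≈A-sound : ∀ {a b} → L ⊢ a ≈A b → ArrEq ρ a b
    ≈A-sound (base a≈b) = ∈-sound a≈b
    ≈A-sound refl = ArrEq-refl ρ _
    ≈A-sound (sym a≈b) = ArrEq-sym ρ (≈A-sound a≈b)
    ≈A-sound (trans a≈b b≈c) = ArrEq-trans ρ (≈A-sound a≈b) (≈A-sound b≈c)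

    ≉S-sound : ∀ {x y} → L ⊢ x ≉S y → ρ x ≢ ρ y
    ≉S-sound (_ , _ , x≈x′ , y≈y′ , x′≉y′) ρx≡ρy =
      [ ∈-sound , (λ y′≉x′ → ∈-sound y′≉x′ ∘ ≡.sym) ]′ x′≉y′
        (≡.trans (≡.sym (≈S-sound x≈x′)) (≡.trans ρx≡ρy (≈S-sound y≈y′)))

    ≉A-sound : ∀ {a b} → L ⊢ a ≉A b → ¬ ArrEq ρ a b
    ≉A-sound (_ , _ , a≈a′ , b≈b′ , a′≉b′) a≡b =
      [ ∈-sound , (λ b′≉a′ → ∈-sound b′≉a′ ∘ ArrEq-sym ρ) ]′ a′≉b′
        (ArrEq-trans ρ (ArrEq-sym ρ (≈A-sound a≈a′)) (ArrEq-trans ρ a≡b (≈A-sound b≈b′)))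

    ¬Conflict : ¬ Conflict L
    ¬Conflict (inj₁ (_ , _ , x≈y , x≉y)) = ≉S-sound x≉y (≈S-sound x≈y)
    ¬Conflict (inj₂ (_ , _ , a≈b , a≉b)) = ≉A-sound a≉b (≈A-sound a≈b)

    Deduce-sound : All (λ c → ⟦ c ⟧ ρ) φ → ∀ {f} → Deduce L f → ⟦ f ⟧ ρ
    Deduce-sound _ (fc-1 s₁ s₂ a≈ i≈) =
      select-congruent ρ (∈-sound s₁) (∈-sound s₂) (≈A-sound a≈) (≈S-sound i≈)
    Deduce-sound _ (fc-2 s₁ s₂ a≈ v≉) ρi≡ρj =
      ≉S-sound v≉ (select-congruent ρ (∈-sound s₁) (∈-sound s₂) (≈A-sound a≈) ρi≡ρj)
    Deduce-sound _ (cong-st s₁ s₂ a≈ i≈ e≈) =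
      store-congruent ρ (∈-sound s₁) (∈-sound s₂) (≈A-sound a≈) (≈S-sound i≈) (≈S-sound e≈)
    Deduce-sound _ (row-1-1 st sl b≈ i≈) =
      read-over-write-hit ρ (∈-sound st) (∈-sound sl) (≈A-sound b≈) (≈S-sound i≈)
    Deduce-sound _ (row-1-2 st sl b≈ v≉) ρi≡ρj =
      ≉S-sound v≉ (read-over-write-hit ρ (∈-sound st) (∈-sound sl) (≈A-sound b≈) ρi≡ρj)
    Deduce-sound _ (row-2-1 st sl b≈ i≉) =
      read-over-write-miss ρ (∈-sound st) (∈-sound sl) (≈A-sound b≈) (≉S-sound i≉)
    Deduce-sound φ-holds (row-2-2 st sl b≈ old v≉) = decidable-stable (_ ℤ.≟ _) λ ρi≢ρj →
      ≉S-sound v≉ (select-congruent ρ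
        (read-over-write-miss ρ (∈-sound st) (∈-sound sl) (≈A-sound b≈) ρi≢ρj)
        (All.lookup φ-holds old) (ArrEq-refl ρ _) refl)
    Deduce-sound _ (clique x≉y y≉z x≉z) = ≉S-sound x≉y , ≉S-sound y≉z , ≉S-sound x≉z

module StoreSize {A : Set} (_≟_ : DecidableEquality A) {n : ℕ} where
  open DecMembership _≟_ using (_∈?_)

  _⊑_ : (Fin n → List A) → (Fin n → List A) → Set
  S′ ⊑ S = ∀ x v → v ∈ S′ x → v ∈ S x

  ⊑-refl : ∀ {S} → S ⊑ S
  ⊑-refl _ _ = id

  ⊑-trans : ∀ {S″ S′ S} → S″ ⊑ S′ → S′ ⊑ S → S″ ⊑ S
  ⊑-trans S″⊑S′ S′⊑S x v = S′⊑S x v ∘ S″⊑S′ x v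

  _∈ₑ_ : Fin n × A → (Fin n → List A) → Set
  (x , v) ∈ₑ S = v ∈ S x

  _∈ₑ?_ : ∀ e S → Dec (e ∈ₑ S)
  (x , v) ∈ₑ? S = v ∈? S x

  Covers : List (Fin n × A) → (Fin n → List A) → Set
  Covers U S = ∀ {e} → e ∈ₑ S → e ∈ U

  entries : (Fin n → List A) → List (Fin n × A)
  entries S = concatMap (λ x → map (x ,_) (S x)) (allFin n)

  entries-covers : ∀ S → Covers (entries S) S
  entries-covers S {x , v} v∈ = ∈-concatMap⁺ (λ y → map (y ,_) (S y)) (lose (∈-allFin x) (∈-map⁺ (x ,_) v∈))

  Covers-⊑ : ∀ {U S S′} → S′ ⊑ S → Covers U S → Covers U S′
  Covers-⊑ S′⊑S covers {x , v} v∈ = covers (S′⊑S x v v∈)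

  -- counted against a fixed list U of entries: a propagator may return domains
  -- with repeated values, so their lengths need not decrease
  size : List (Fin n × A) → (Fin n → List A) → ℕ
  size U S = length (filter (_∈ₑ? S) U)

  size-strict : ∀ {U S S′ x v} → S′ ⊑ S → Covers U S → v ∈ S x → v ∉ S′ x → size U S′ < size U S
  size-strict {U} {S} {S′} S′⊑S covers v∈ v∉ =
    length-filter-strict (_∈ₑ? S) (_∈ₑ? S′) (λ {(x , v)} → S′⊑S x v) U (covers v∈) v∈ v∉

module AtomKeys (n m : ℕ) where

  -- codes for the atoms propagation may add as facts: eqS, neqS, eqA, sel and alldiff
  Key : Set
  Key = (Fin n × Fin n) ⊎ (Fin n × Fin n) ⊎ (Fin m × Fin m) ⊎ (Fin n × Fin m × Fin n) ⊎ (Fin n × Fin n × Fin n)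

  atomOf : Key → Atom n m
  atomOf (inj₁ (x , y)) = eqS x y
  atomOf (inj₂ (inj₁ (x , y))) = neqS x y
  atomOf (inj₂ (inj₂ (inj₁ (a , b)))) = eqA a b
  atomOf (inj₂ (inj₂ (inj₂ (inj₁ (v , a , i))))) = sel v a i
  atomOf (inj₂ (inj₂ (inj₂ (inj₂ (x , y , z))))) = alldiff x y z

  key : Atom n m → Maybe Key
  key (eqS x y) = just (inj₁ (x , y))
  key (neqS x y) = just (inj₂ (inj₁ (x , y)))
  key (eqA a b) = just (inj₂ (inj₂ (inj₁ (a , b))))
  key (neqA _ _) = nothing
  key (sel v a i) = just (inj₂ (inj₂ (inj₂ (inj₁ (v , a , i)))))
  key (sto _ _ _ _) = nothing
  key (alldiff x y z) = just (inj₂ (inj₂ (inj₂ (inj₂ (x , y , z)))))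
  key (user _) = nothing

  key-atomOf : ∀ k → key (atomOf k) ≡ just k
  key-atomOf (inj₁ _) = refl
  key-atomOf (inj₂ (inj₁ _)) = refl
  key-atomOf (inj₂ (inj₂ (inj₁ _))) = refl
  key-atomOf (inj₂ (inj₂ (inj₂ (inj₁ _)))) = refl
  key-atomOf (inj₂ (inj₂ (inj₂ (inj₂ _)))) = refl

  key⇒atomOf : ∀ f {k} → key f ≡ just k → atomOf k ≡ f
  key⇒atomOf (eqS _ _) refl = refl
  key⇒atomOf (neqS _ _) refl = refl
  key⇒atomOf (eqA _ _) refl = refl
  key⇒atomOf (sel _ _ _) refl = refl
  key⇒atomOf (alldiff _ _ _) refl = refl

  _≟ₖ_ : DecidableEquality Key
  _≟ₖ_ = Sum.≡-dec fin² (Sum.≡-dec fin² (Sum.≡-dec fin² (Sum.≡-dec fin³ fin³)))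
    where
    fin² : ∀ {k l} → DecidableEquality (Fin k × Fin l)
    fin² = Product.≡-dec Fin._≟_ Fin._≟_
    fin³ : ∀ {k l o} → DecidableEquality (Fin k × Fin l × Fin o)
    fin³ = Product.≡-dec Fin._≟_ fin²

  keys : List Key
  keys = finPairs ⊕ finPairs ⊕ finPairs ⊕ cartesianProduct (allFin n) finPairs ⊕ cartesianProduct (allFin n) finPairs
    where
    finPairs : ∀ {k l} → List (Fin k × Fin l)
    finPairs = cartesianProduct (allFin _) (allFin _)

  ∈-keys : ∀ k → k ∈ keys
  ∈-keys = ⊕-complete pairs (⊕-complete pairs (⊕-complete pairs
             (⊕-complete (⊗-complete ∈-allFin pairs) (⊗-complete ∈-allFin pairs))))
    where
    pairs : ∀ {k l} (p : Fin k × Fin l) → p ∈ cartesianProduct (allFin k) (allFin l)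
    pairs = ⊗-complete ∈-allFin ∈-allFin

  known? : ∀ k L → Dec (atomOf k ∈ L)
  known? k L = map′ (Any.map (λ {f} → key⇒atomOf f)) (Any.map λ { refl → key-atomOf k })
                 (any? (λ f → Maybe.≡-dec _≟ₖ_ (key f) (just k)) L)

  unknown : List (Atom n m) → ℕ
  unknown L = length (filter (λ k → ¬? (known? k L)) keys)

  unknown-add : ∀ {L} k → atomOf k ∉ L → unknown (atomOf k ∷ L) < unknown L
  unknown-add {L} k k∉L =
    length-filter-strict (λ k′ → ¬? (known? k′ L)) (λ k′ → ¬? (known? k′ (atomOf k ∷ L)))
    (λ k′∉k∷L k′∈L → k′∉k∷L (there k′∈L)) keys (∈-keys k) k∉L (λ k∉k∷L → k∉k∷L (here refl))

module FDCC (F : Formula) (prop : Semantics.Propagators F) (SC : Semantics.StronglyCorrect F prop) where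
  open Formula F
  open Semantics F
  open Procedure prop
  open StronglyCorrect SC
  open ArraySemantics F
  open StoreSize ℤ._≟_ {n}
  open AtomKeys n m

  ∈⇒Entailed : ∀ {L} f → f ∈ L → Entailed L f
  ∈⇒Entailed (eqS _ _) f∈ = base f∈
  ∈⇒Entailed (neqS x y) f∈ = x , y , refl , refl , inj₁ f∈
  ∈⇒Entailed (eqA _ _) f∈ = base f∈
  ∈⇒Entailed (neqA a b) f∈ = a , b , refl , refl , inj₁ f∈
  ∈⇒Entailed (sel _ _ _) f∈ = f∈
  ∈⇒Entailed (sto _ _ _ _) f∈ = f∈
  ∈⇒Entailed (alldiff _ _ _) f∈ = f∈
  ∈⇒Entailed (user _) _ = tt

  Deduce-key : ∀ {L f} → Deduce L f → Σ Key λ k → atomOf k ≡ f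
  Deduce-key (fc-1 {v = v} {w} _ _ _ _) = inj₁ (v , w) , refl
  Deduce-key (fc-2 {i = i} {j} _ _ _ _) = inj₂ (inj₁ (i , j)) , refl
  Deduce-key (cong-st {b = b} {b′} _ _ _ _ _) = inj₂ (inj₂ (inj₁ (b , b′))) , refl
  Deduce-key (row-1-1 {e = e} {v} _ _ _ _) = inj₁ (v , e) , refl
  Deduce-key (row-1-2 {i = i} {j = j} _ _ _ _) = inj₂ (inj₁ (i , j)) , refl
  Deduce-key (row-2-1 {a = a} {v = v} {j} _ _ _ _) = inj₂ (inj₂ (inj₂ (inj₁ (v , a , j)))) , refl
  Deduce-key (row-2-2 {i = i} {j = j} _ _ _ _ _) = inj₁ (i , j) , refl
  Deduce-key (clique {x} {y} {z} _ _ _) = inj₂ (inj₂ (inj₂ (inj₂ (x , y , z)))) , refl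

  ⟶-⊑ : ∀ {s s′} → s ⟶ s′ → store s′ ⊑ store s
  ⟶-⊑ (cc _ _ _) = ⊑-refl
  ⟶-⊑ (supEq _ _ _ _) = ⊑-refl
  ⟶-⊑ (supNeq _ _ _ _) = ⊑-refl
  ⟶-⊑ {s} (fd {c = c} _ _ _) = filtering c (store s)

  μ : List (Fin n × ℤ) → State → ℕ
  μ U s = size U (store s) + unknown (facts s)

  add-fact-decreases : ∀ U {s f} → Σ Key (λ k → atomOf k ≡ f) → ¬ Entailed (posted s) f →
                       μ U (mkState (store s) (f ∷ facts s)) < μ U s
  add-fact-decreases U {s} (k , refl) not-entailed = +-monoʳ-< (size U (store s))
    (unknown-add k λ k∈ → not-entailed (∈⇒Entailed (atomOf k) (∈-++⁺ʳ φ k∈)))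

  remove-value-decreases : ∀ U {s s′ x v} → Covers U (store s) → store s′ ⊑ store s → facts s′ ≡ facts s →
                           v ∈ store s x → v ∉ store s′ x → μ U s′ < μ U s
  remove-value-decreases U {s} covers s′⊑s refl v∈ v∉ =
    +-monoˡ-< (unknown (facts s)) (size-strict s′⊑s covers v∈ v∉)

  ⟶-decreases : ∀ U {s s′} → s ⟶ s′ → Covers U (store s) → Covers U (store s′) × μ U s′ < μ U s
  ⟶-decreases U {s} {s′} step covers = Covers-⊑ (⟶-⊑ step) covers , decreases step
    where
    decreases : s ⟶ s′ → μ U s′ < μ U s
    decreases (cc _ d not-entailed) = add-fact-decreases U (Deduce-key d) not-entailed
    decreases (supEq {x = x} {y} _ _ _ not-entailed) = add-fact-decreases U (inj₁ (x , y) , refl) not-entailed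
    decreases (supNeq {x = x} {y} _ _ _ not-entailed) = add-fact-decreases U (inj₂ (inj₁ (x , y)) , refl) not-entailed
    decreases (fd _ _ (_ , _ , v∈ , v∉)) = remove-value-decreases U covers (⟶-⊑ step) refl v∈ v∉

  ⟶-wellFounded : WellFounded (flip _⟶_)
  ⟶-wellFounded s = accessible-by-measure (Covers U ∘ store) (μ U) (⟶-decreases U) (entries-covers (store s))
    where U = entries (store s)

  posted-holds : ∀ {ρ s} → Solution ρ → Compatible ρ s → All (λ c → ⟦ c ⟧ ρ) (posted s)
  posted-holds (_ , φ-holds) (_ , facts-hold) = ++⁺ φ-holds facts-hold

  Compatible-⟶ : ∀ {ρ s s′} → Solution ρ → s ⟶ s′ → Compatible ρ s → Compatible ρ s′
  Compatible-⟶ {ρ} sol (cc _ d _) compat@(in-store , facts-hold) =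
    in-store , Deduce-sound ρ (posted-holds sol compat) (proj₂ sol) d ∷ facts-hold
  Compatible-⟶ {ρ} _ (supEq {x = x} {y} _ _ dom-eq _) (in-store , facts-hold) =
    in-store , dom-eq (ρ x) (ρ y) (in-store x) (in-store y) ∷ facts-hold
  Compatible-⟶ {ρ} _ (supNeq {x = x} {y} _ _ dom-neq _) (in-store , facts-hold) =
    in-store , dom-neq (ρ x) (ρ y) (in-store x) (in-store y) ∷ facts-hold
  Compatible-⟶ {ρ} {s} sol (fd {c = c} _ c∈ _) compat@(in-store , facts-hold) =
    correct c (store s) ρ in-store (All.lookup (posted-holds sol compat) c∈) , facts-hold

  propagation-correct : ∀ ρ s s′ → Solution ρ → Compatible ρ s → Star _⟶_ s s′ → Compatible ρ s′
  propagation-correct ρ s s′ sol compat steps = Star-preserves (Compatible-⟶ sol) steps compat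

  Compatible⇒¬Failed : ∀ {ρ s} → Solution ρ → Compatible ρ s → ¬ Failed s
  Compatible⇒¬Failed {ρ} _ (in-store , _) (inj₁ (x , empty)) = empty (ρ x) (in-store x)
  Compatible⇒¬Failed sol compat (inj₂ conflict) = ¬Conflict _ (posted-holds sol compat) conflict

  setDom-∈ : ∀ S x l y {w} → (y ≡ x → w ∈ l) → (y ≢ x → w ∈ S y) → w ∈ setDom S x l y
  setDom-∈ S x l y in-l in-S with y Fin.≟ x
  ... | yes y≡x = in-l y≡x
  ... | no y≢x = in-S y≢x

  setDom-⊑ : ∀ {S x l} → (∀ w → w ∈ l → w ∈ S x) → setDom S x l ⊑ S
  setDom-⊑ {x = x} l⊆Sx y w w∈ with y Fin.≟ x
  ... | yes refl = l⊆Sx w w∈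
  ... | no _ = w∈

  setDom-at : ∀ S x l → setDom S x l x ≡ l
  setDom-at S x l with x Fin.≟ x
  ... | yes _ = refl
  ... | no x≢x = ⊥-elim (x≢x refl)

  _≢?_ : ∀ v k → Dec (v ≢ k)
  v ≢? k = ¬? (v ℤ.≟ k)

  without : ℤ → List ℤ → List ℤ
  without k = filter (_≢? k)

  assign-⊑ : ∀ s x {k} → k ∈ store s x → store (assign s x k) ⊑ store s
  assign-⊑ s x k∈ = setDom-⊑ λ { _ (here refl) → k∈ }

  exclude-⊑ : ∀ s x k → store (exclude s x k) ⊑ store s
  exclude-⊑ s x k = setDom-⊑ λ w w∈ → proj₁ (∈-filter⁻ (_≢? k) w∈)

  assign-removes : ∀ s x {k v} → v ≢ k → v ∉ store (assign s x k) x
  assign-removes s x {k} v≢k v∈ rewrite setDom-at (store s) x (k ∷ []) with v∈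
  ... | here v≡k = v≢k v≡k

  exclude-removes : ∀ s x k → k ∉ store (exclude s x k) x
  exclude-removes s x k k∈ rewrite setDom-at (store s) x (without k (store s x)) =
    proj₂ (∈-filter⁻ (_≢? k) {xs = store s x} k∈) refl

  assign-compatible : ∀ {ρ s x k} → ρ x ≡ k → Compatible ρ s → Compatible ρ (assign s x k)
  assign-compatible {ρ} {s} {x} {k} ρx≡k (in-store , facts-hold) =
    (λ y → setDom-∈ (store s) x (k ∷ []) y (λ { refl → here ρx≡k }) (λ _ → in-store y)) , facts-hold

  exclude-compatible : ∀ {ρ s x k} → ρ x ≢ k → Compatible ρ s → Compatible ρ (exclude s x k)
  exclude-compatible {ρ} {s} {x} {k} ρx≢k (in-store , facts-hold) =
    (λ y → setDom-∈ (store s) x (without k (store s x)) y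
             (λ { refl → ∈-filter⁺ (_≢? k) (in-store x) ρx≢k }) (λ _ → in-store y)) , facts-hold

  Covers-stack : List (Fin n × ℤ) → Config → Set
  Covers-stack U (search st) = All (Covers U ∘ store) st
  Covers-stack U _ = ⊤

  -- the suc makes the final step search [] ⇒ unsat decrease as well
  weight : List (Fin n × ℤ) → Config → ℕ
  weight U (search st) = suc (sum (map (λ s → 3 ^ μ U s) st))
  weight U _ = 0

  ⇒-decreases : ∀ U {c c′} → c ⇒ c′ → Covers-stack U c → Covers-stack U c′ × weight U c′ < weight U c
  ⇒-decreases U exhausted _ = tt , s≤s z≤n
  ⇒-decreases U (propagate step) (covers ∷ rest) =
    let (covers′ , lt) = ⟶-decreases U step covers in
    covers′ ∷ rest , s≤s (+-monoˡ-< _ (^-monoʳ-< 3 (s≤s (s≤s z≤n)) lt))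
  ⇒-decreases U (backtrack {s} _ _) (_ ∷ rest) = rest , s≤s (+-monoˡ-< _ (m^n>0 3 (μ U s)))
  ⇒-decreases U (accept _ _ _ _) _ = tt , s≤s z≤n
  ⇒-decreases U (reject {s} _ _ _ _) (_ ∷ rest) = rest , s≤s (+-monoˡ-< _ (m^n>0 3 (μ U s)))
  ⇒-decreases U (label {s} {st} {x} {k} {v} _ _ k∈ v∈ v≢k) (covers ∷ rest) =
    Covers-⊑ (assign-⊑ s x k∈) covers ∷ Covers-⊑ (exclude-⊑ s x k) covers ∷ rest , s≤s (begin-strict
      3 ^ μ U (assign s x k) + (3 ^ μ U (exclude s x k) + W)
        ≡⟨ ≡.sym (+-assoc (3 ^ μ U (assign s x k)) _ W) ⟩
      3 ^ μ U (assign s x k) + 3 ^ μ U (exclude s x k) + W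
        <⟨ +-monoˡ-< W (3^m+3^n<3^o
             (remove-value-decreases U covers (assign-⊑ s x k∈) refl v∈ (assign-removes s x v≢k))
             (remove-value-decreases U covers (exclude-⊑ s x k) refl k∈ (exclude-removes s x k))) ⟩
      3 ^ μ U s + W ∎)
    where
    open ≤-Reasoning
    W = sum (map (λ s → 3 ^ μ U s) st)

  stack-covered : ∀ st → All (Covers (concatMap (entries ∘ store) st) ∘ store) st
  stack-covered st = All.tabulate λ s∈ e∈ → ∈-concatMap⁺ (entries ∘ store) (lose s∈ (entries-covers _ e∈))

  ⇒-wellFounded : WellFounded (flip _⇒_)
  ⇒-wellFounded (search st) = accessible-by-measure (Covers-stack U) (weight U) (⇒-decreases U) (stack-covered st)
    where U = concatMap (entries ∘ store) st
  ⇒-wellFounded (sat _) = acc λ ()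
  ⇒-wellFounded unsat = acc λ ()

  TwoValues : List ℤ → Set
  TwoValues l = ∃₂ λ k v → k ∈ l × v ∈ l × v ≢ k

  twoValues? : ∀ l → Dec (TwoValues l)
  twoValues? l with any? (λ k → any? (_≢? k) l) l
  ... | yes some = let (k , k∈ , some′) = find some
                       (v , v∈ , v≢k) = find some′ in yes (k , v , k∈ , v∈ , v≢k)
  ... | no none = no λ (k , v , k∈ , v∈ , v≢k) → none (lose k∈ (lose v∈ v≢k))

  singleton : ∀ l → ¬ (∀ v → v ∉ l) → ¬ TwoValues l → ∃ λ k → k ∈ l × ∀ v → v ∈ l → v ≡ k
  singleton [] nonempty _ = ⊥-elim (nonempty λ _ ())
  singleton (k ∷ _) _ ¬two = k , here refl , λ v v∈ →
    decidable-stable (v ℤ.≟ k) λ v≢k → ¬two (k , v , here refl , v∈ , v≢k)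

  search-not-final : ∀ st → ¬ ¬ ∃ (search st ⇒_)
  search-not-final [] final = final (_ , exhausted)
  search-not-final (s ∷ st) final with Fin.any? (λ x → twoValues? (store s x))
  ... | yes (x , k , v , k∈ , v∈ , v≢k) = final (_ , label stuck ¬failed k∈ v∈ v≢k)
    where
    stuck : Stuck s
    stuck (_ , step) = final (_ , propagate step)
    ¬failed : ¬ Failed s
    ¬failed failed = final (_ , backtrack stuck failed)
  ... | no none = final (_ , reject stuck ¬failed instantiated λ accepted →
                    final (_ , accept stuck ¬failed instantiated accepted))
    where
    stuck : Stuck s
    stuck (_ , step) = final (_ , propagate step)
    ¬failed : ¬ Failed s
    ¬failed failed = final (_ , backtrack stuck failed)
    value : ∀ x → ∃ λ k → k ∈ store s x × ∀ v → v ∈ store s x → v ≡ k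
    value x = singleton (store s x) (λ empty → ¬failed (inj₁ (x , empty))) (λ two → none (x , two))
    instantiated : Instantiated (store s) (proj₁ ∘ value)
    instantiated = proj₂ ∘ value

  final⇒IsAnswer : ∀ c → ¬ ∃ (c ⇒_) → IsAnswer c
  final⇒IsAnswer (search st) final = ⊥-elim (search-not-final st final)
  final⇒IsAnswer (sat ρ) _ = isSat ρ
  final⇒IsAnswer unsat _ = isUnsat

  Instantiated-to : ∀ {S ρ ρ′} → Instantiated S ρ′ → InStore ρ S → Instantiated S ρ
  Instantiated-to {ρ = ρ} inst in-store x =
    in-store x , λ v v∈ → ≡.trans (proj₂ (inst x) v v∈) (≡.sym (proj₂ (inst x) (ρ x) (in-store x)))

  -- a solution ρ is never lost: it stays compatible with some pending state
  Pending : Assignment → Config → Set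
  Pending ρ (search st) = Any (Compatible ρ) st
  Pending ρ (sat _) = ⊤
  Pending ρ unsat = ⊥

  Pending-⇒ : ∀ {ρ c c′} → Solution ρ → c ⇒ c′ → Pending ρ c → Pending ρ c′
  Pending-⇒ sol (propagate step) (here compat) = here (Compatible-⟶ sol step compat)
  Pending-⇒ sol (propagate _) (there pending) = there pending
  Pending-⇒ sol (backtrack _ failed) (here compat) = ⊥-elim (Compatible⇒¬Failed sol compat failed)
  Pending-⇒ sol (backtrack _ _) (there pending) = pending
  Pending-⇒ sol (accept _ _ _ _) _ = tt
  Pending-⇒ {ρ} sol (reject {s} _ _ inst ¬accepted) (here compat) = ⊥-elim (¬accepted λ c c∈ →
    accepts′ c (store s) ρ (Instantiated-to inst (proj₁ compat)) (All.lookup (posted-holds sol compat) c∈))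
  Pending-⇒ sol (reject _ _ _ _) (there pending) = pending
  Pending-⇒ {ρ} sol (label {x = x} {k} _ _ _ _ _) (here compat) with ρ x ℤ.≟ k
  ... | yes ρx≡k = here (assign-compatible ρx≡k compat)
  ... | no ρx≢k = there (here (exclude-compatible ρx≢k compat))
  Pending-⇒ sol (label _ _ _ _ _) (there pending) = there (there pending)

  unsat-sound : Star _⇒_ start unsat → ¬ ∃ Solution
  unsat-sound run (ρ , sol) = Star-preserves (Pending-⇒ sol) run (here (proj₁ sol , []))

  WithinDomains : Config → Set
  WithinDomains (search st) = All (λ s → store s ⊑ D) st
  WithinDomains (sat ρ) = Solution ρ
  WithinDomains unsat = ⊤

  WithinDomains-⇒ : ∀ {c c′} → c ⇒ c′ → WithinDomains c → WithinDomains c′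
  WithinDomains-⇒ exhausted _ = tt
  WithinDomains-⇒ (propagate step) (s⊑D ∷ rest) = ⊑-trans (⟶-⊑ step) s⊑D ∷ rest
  WithinDomains-⇒ (backtrack _ _) (_ ∷ rest) = rest
  WithinDomains-⇒ (accept {s} {ρ = ρ} _ _ inst accepted) (s⊑D ∷ _) =
    (λ x → s⊑D x (ρ x) (proj₁ (inst x))) ,
    All.tabulate λ {c} c∈ → accepts c (store s) ρ inst (accepted c (∈-++⁺ˡ c∈))
  WithinDomains-⇒ (reject _ _ _ _) (_ ∷ rest) = rest
  WithinDomains-⇒ (label {s} {x = x} {k} _ _ k∈ _ _) (s⊑D ∷ rest) =
    ⊑-trans (assign-⊑ s x k∈) s⊑D ∷ ⊑-trans (exclude-⊑ s x k) s⊑D ∷ rest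

  sat-sound : ∀ ρ → Star _⇒_ start (sat ρ) → Solution ρ
  sat-sound ρ run = Star-preserves WithinDomains-⇒ run (⊑-refl ∷ [])

mainTheorem1 : (F : Formula) (prop : Semantics.Propagators F) →
    Semantics.StronglyCorrect F prop →
    let open Semantics F
        open Procedure prop
    in
    WellFounded (flip _⟶_)
    × (∀ ρ s s′ → Solution ρ → Compatible ρ s → Star _⟶_ s s′ → Compatible ρ s′)
    × WellFounded (flip _⇒_)
    × (∀ c → Star _⇒_ start c → ¬ (∃ λ c′ → c ⇒ c′) → IsAnswer c)
    × (Star _⇒_ start unsat → ¬ (∃ λ ρ → Solution ρ))
    × (∀ ρ → Star _⇒_ start (sat ρ) → Solution ρ)
mainTheorem1 F prop strongly-correct =
  ⟶-wellFounded , propagation-correct , ⇒-wellFounded , (λ c _ → final⇒IsAnswer c) , unsat-sound , sat-sound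
  where open FDCC F prop strongly-correct
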